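{- Let $a,k,n$ be integers with $a>0$ and $n\geq 3$. Let $\mathbf{x}=(x_1,\dots,x_n)\in V_{a,k,n}(\mathbb{Z})\setminus\mathfrak{T}(a,k,n)$ and let $i\in\{1,\dots,n\}$. If $$|a x_1\cdots x_{i-1}x_{i+1}\cdots x_n-x_i|\leq |x_i|,$$ then $|x_j|<|x_i|$ for all $j\neq i$.
   Context: $V_{a,k,n}(\mathbb{Z})$ is the set of integer solutions $(x_1,\dots,x_n)\in\mathbb{Z}^n$ of $x_1^2+\cdots+x_n^2-a x_1\cdots x_n=k$. $\mathfrak{T}(a,k,n)$ is the set of $\mathbf{x}\in V_{a,k,n}(\mathbb{Z})$ such that $|a x_{i_1}\cdots x_{i_{n-2}}|\leq 2$ for some indices $1\leq i_1<\cdots<i_{n-2}\leq n$. So $\mathbf{x}\notin\mathfrak{T}(a,k,n)$ means that $|a x_{i_1}\cdots x_{i_{n-2}}|>2$ for every choice of $n-2$ distinct indices. -}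

module Defs where

open import Data.Nat using (ℕ)
open import Data.Integer using (ℤ; _+_; _-_; _*_; ∣_∣; +_)
open import Data.Fin using (Fin)
open import Data.Fin.Subset using (Subset)
import Data.Fin.Subset as Sub
import Data.Nat as ℕ
open import Data.Vec.Functional using (Vector; foldr)
open import Relation.Binary.PropositionalEquality using (_≡_)
open import Relation.Nullary using (¬_)
open import Data.Product using (Σ; ∃; _×_)
open import Data.Bool using (Bool; true; false; if_then_else_)
open import Data.Vec using (lookup)

sumℤ : ∀ {n} → Vector ℤ n → ℤ
sumℤ = foldr _+_ (+ 0)

prodℤ : ∀ {n} → Vector ℤ n → ℤ
prodℤ = foldr _*_ (+ 1)

prodOver : ∀ {n} → Subset n → Vector ℤ n → ℤ
prodOver S x = prodℤ (λ j → if lookup S j then x j else + 1)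

InV : (a k : ℤ) (n : ℕ) → Vector ℤ n → Set
InV a k n x = sumℤ (λ j → x j * x j) - a * prodℤ x ≡ k

InT : (a k : ℤ) (n : ℕ) → Vector ℤ n → Set
InT a k n x = InV a k n x ×
  Σ (Subset n) (λ S → (Sub.∣ S ∣ ℕ.+ 2 ≡ n) ×
                      (∣ a * prodOver S x ∣ ℕ.≤ 2))

{-# OPTIONS --safe #-}
-- Write P = a·∏_{l≠i} x_l and, for j ≠ i, P = x_j·c with c = a·∏_{l≠i,j} x_l. Since x ∉ 𝔗,
-- |c| ≥ 3, while the hypothesis and the triangle inequality give |x_j|·|c| = |P| ≤ 2|x_i|;
-- hence 3|x_j| ≤ 2|x_i|. This forces |x_j| < |x_i| once x_i ≠ 0, and x_i = 0 is impossible: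
-- for a third index k the product of a over the n-2 indices other than j, k contains x_i,
-- so it vanishes and would put x in 𝔗.

module Submission where

open import Defs
open import Data.Nat using (ℕ; _≥_; _<_; zero; suc; s≤s; >-nonZero)
import Data.Nat as ℕ
import Data.Nat.Properties as ℕP
open import Data.Integer using (ℤ; _-_; _*_; ∣_∣; +_; _>_)
import Data.Integer.Properties as ℤP
open import Algebra.Bundles using (AbelianGroup)
open import Algebra.Properties.Group (AbelianGroup.group ℤP.+-0-abelianGroup) using (//-rightDividesˡ)
open import Algebra.Properties.CommutativeSemigroup ℤP.*-commutativeSemigroup using (x∙yz≈y∙xz)
open import Data.Fin using (Fin; zero; suc)
open import Data.Fin.Subset using (Subset; ⁅_⁆; ∁; _∈_; inside; outside)
import Data.Fin.Subset as Sub
open import Data.Fin.Subset.Properties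
  using (∣∁p∣≡n∸∣p∣; ∣⁅x⁆∣≡1; p─⊥≡p; x∉p⇒x∈∁p; x≢y⇒x∉⁅y⁆; x∈p∧x≢y⇒x∈p-y)
open import Data.Bool using (if_then_else_)
open import Data.Vec using (_∷_; here; there)
open import Data.Vec.Functional using (Vector)
open import Data.Product using (∃; _×_; _,_)
open import Function using (_∘_)
open import Relation.Binary.PropositionalEquality
  using (_≡_; _≢_; sym; trans; cong; subst; ≢-sym; module ≡-Reasoning)
open import Relation.Nullary using (¬_)

∣∁⁅x⁆∣≡n : ∀ {n} (i : Fin (suc n)) → Sub.∣ ∁ ⁅ i ⁆ ∣ ≡ n
∣∁⁅x⁆∣≡n {n} i = trans (∣∁p∣≡n∸∣p∣ ⁅ i ⁆) (cong (suc n ℕ.∸_) (∣⁅x⁆∣≡1 i))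

x∈p⇒1+∣p-x∣≡∣p∣ : ∀ {n} {p : Subset n} {i} → i ∈ p → suc Sub.∣ p Sub.- i ∣ ≡ Sub.∣ p ∣
x∈p⇒1+∣p-x∣≡∣p∣ {p = inside ∷ p} here = cong (suc ∘ Sub.∣_∣) (p─⊥≡p p)
x∈p⇒1+∣p-x∣≡∣p∣ {p = inside ∷ p} (there i∈p) = cong suc (x∈p⇒1+∣p-x∣≡∣p∣ i∈p)
x∈p⇒1+∣p-x∣≡∣p∣ {p = outside ∷ p} (there i∈p) = x∈p⇒1+∣p-x∣≡∣p∣ i∈p

x≢y⇒x∈∁⁅y⁆ : ∀ {n} {i j : Fin n} → i ≢ j → i ∈ ∁ ⁅ j ⁆
x≢y⇒x∈∁⁅y⁆ = x∉p⇒x∈∁p ∘ x≢y⇒x∉⁅y⁆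

∣∁⁅x⁆-y∣+2≡n : ∀ {n} {i j : Fin n} → j ≢ i → Sub.∣ ∁ ⁅ i ⁆ Sub.- j ∣ ℕ.+ 2 ≡ n
∣∁⁅x⁆-y∣+2≡n {suc n} {i} {j} j≢i = begin
  Sub.∣ ∁ ⁅ i ⁆ Sub.- j ∣ ℕ.+ 2    ≡⟨ ℕP.+-comm _ 2 ⟩
  suc (suc Sub.∣ ∁ ⁅ i ⁆ Sub.- j ∣) ≡⟨ cong suc (x∈p⇒1+∣p-x∣≡∣p∣ (x≢y⇒x∈∁⁅y⁆ j≢i)) ⟩
  suc Sub.∣ ∁ ⁅ i ⁆ ∣               ≡⟨ cong suc (∣∁⁅x⁆∣≡n i) ⟩
  suc n                             ∎
  where open ≡-Reasoning

prodOver-extract : ∀ {n} {p : Subset n} {i} (x : Vector ℤ n) → i ∈ p →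
  prodOver p x ≡ x i * prodOver (p Sub.- i) x
prodOver-extract {p = inside ∷ p} x here =
  cong (x zero *_) (sym (trans (ℤP.*-identityˡ _) (cong (λ q → prodOver q (x ∘ suc)) (p─⊥≡p p))))
prodOver-extract {p = b ∷ p} {suc i} x (there i∈p) = begin
  c * prodOver p (x ∘ suc)                          ≡⟨ cong (c *_) (prodOver-extract (x ∘ suc) i∈p) ⟩
  c * (x (suc i) * prodOver (p Sub.- i) (x ∘ suc))  ≡⟨ x∙yz≈y∙xz c (x (suc i)) _ ⟩
  x (suc i) * (c * prodOver (p Sub.- i) (x ∘ suc))  ∎
  where
  open ≡-Reasoning
  c = if b then x zero else + 1

∣i∣≤∣i-j∣+∣j∣ : ∀ i j → ∣ i ∣ ℕ.≤ ∣ i - j ∣ ℕ.+ ∣ j ∣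
∣i∣≤∣i-j∣+∣j∣ i j =
  subst (λ t → ∣ t ∣ ℕ.≤ ∣ i - j ∣ ℕ.+ ∣ j ∣) (//-rightDividesˡ j i) (ℤP.∣i+j∣≤∣i∣+∣j∣ (i - j) j)

m*c≤n+n⇒m<n : ∀ {m n c} → 2 < c → 0 < n → m ℕ.* c ℕ.≤ n ℕ.+ n → m < n
m*c≤n+n⇒m<n {m} {n} {c} 2<c 0<n m*c≤n+n = ℕP.*-cancelˡ-< 3 m n (begin-strict
  3 ℕ.* m      ≤⟨ ℕP.*-monoˡ-≤ m 2<c ⟩
  c ℕ.* m      ≡⟨ ℕP.*-comm c m ⟩
  m ℕ.* c      ≤⟨ m*c≤n+n ⟩
  n ℕ.+ n      ≡⟨ cong (n ℕ.+_) (sym (ℕP.+-identityʳ n)) ⟩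
  2 ℕ.* n      <⟨ ℕP.*-monoˡ-< n {{>-nonZero 0<n}} (ℕP.n<1+n 2) ⟩
  3 ℕ.* n      ∎)
  where open ℕP.≤-Reasoning

avoid-two : ∀ {m} (i j : Fin (3 ℕ.+ m)) → ∃ λ k → k ≢ i × k ≢ j
avoid-two zero          zero           = suc zero , (λ ()) , (λ ())
avoid-two zero          (suc zero)     = suc (suc zero) , (λ ()) , (λ ())
avoid-two zero          (suc (suc _))  = suc zero , (λ ()) , (λ ())
avoid-two (suc zero)    zero           = suc (suc zero) , (λ ()) , (λ ())
avoid-two (suc (suc _)) zero           = suc zero , (λ ()) , (λ ())
avoid-two (suc _)       (suc _)        = zero , (λ ()) , (λ ())

prodOver-∁⁅x⁆ : ∀ {n} (a : ℤ) (x : Vector ℤ n) {i j : Fin n} → j ≢ i →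
  a * prodOver (∁ ⁅ i ⁆) x ≡ x j * (a * prodOver (∁ ⁅ i ⁆ Sub.- j) x)
prodOver-∁⁅x⁆ a x j≢i =
  trans (cong (a *_) (prodOver-extract x (x≢y⇒x∈∁⁅y⁆ j≢i))) (x∙yz≈y∙xz a (x _) _)

module OutsideT {a k : ℤ} {n : ℕ} {x : Vector ℤ n} (x∈V : InV a k n x) (x∉T : ¬ InT a k n x) where

  ∉T⇒2<∣a*prodOver∣ : (S : Subset n) → Sub.∣ S ∣ ℕ.+ 2 ≡ n → 2 < ∣ a * prodOver S x ∣
  ∉T⇒2<∣a*prodOver∣ S ∣S∣+2≡n = ℕP.≰⇒> (λ small → x∉T (x∈V , S , ∣S∣+2≡n , small))

  ∉T⇒x≢0 : {i j k : Fin n} → i ≢ j → i ≢ k → k ≢ j → x i ≢ + 0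
  ∉T⇒x≢0 {i} {j} {k} i≢j i≢k k≢j xᵢ≡0 =
    ℕP.n≮0 (subst (2 <_) ∣a*prodOver∣≡0 (∉T⇒2<∣a*prodOver∣ S (∣∁⁅x⁆-y∣+2≡n k≢j)))
    where
    S = ∁ ⁅ j ⁆ Sub.- k
    ∣a*prodOver∣≡0 : ∣ a * prodOver S x ∣ ≡ 0
    ∣a*prodOver∣≡0 = begin
      ∣ a * prodOver S x ∣                    ≡⟨ cong (λ t → ∣ a * t ∣) (prodOver-extract x i∈S) ⟩
      ∣ a * (x i * prodOver (S Sub.- i) x) ∣  ≡⟨ cong (λ t → ∣ a * (t * prodOver (S Sub.- i) x) ∣) xᵢ≡0 ⟩
      ∣ a * + 0 ∣                             ≡⟨ cong ∣_∣ (ℤP.*-zeroʳ a) ⟩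
      0                                       ∎
      where
      open ≡-Reasoning
      i∈S : i ∈ S
      i∈S = x∈p∧x≢y⇒x∈p-y (x≢y⇒x∈∁⁅y⁆ i≢j) i≢k

lemma2p1 : (a k : ℤ) (n : ℕ) → a > + 0 → n ≥ 3 →
    (x : Vector ℤ n) → InV a k n x → ¬ InT a k n x →
    (i : Fin n) →
    ∣ a * prodOver (∁ ⁅ i ⁆) x - x i ∣ ℕ.≤ ∣ x i ∣ →
    (j : Fin n) → ¬ j ≡ i → ∣ x j ∣ < ∣ x i ∣
lemma2p1 a k (suc (suc (suc _))) _ _ x x∈V x∉T i close j j≢i =
  m*c≤n+n⇒m<n (∉T⇒2<∣a*prodOver∣ (∁ ⁅ i ⁆ Sub.- j) (∣∁⁅x⁆-y∣+2≡n j≢i)) 0<∣xᵢ∣ ∣xⱼ∣*∣c∣≤2∣xᵢ∣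
  where
  open OutsideT {a} {k} {_} {x} x∈V x∉T
  open ℕP.≤-Reasoning
  P = a * prodOver (∁ ⁅ i ⁆) x
  c = a * prodOver (∁ ⁅ i ⁆ Sub.- j) x
  ∣xⱼ∣*∣c∣≤2∣xᵢ∣ : ∣ x j ∣ ℕ.* ∣ c ∣ ℕ.≤ ∣ x i ∣ ℕ.+ ∣ x i ∣
  ∣xⱼ∣*∣c∣≤2∣xᵢ∣ = begin
    ∣ x j ∣ ℕ.* ∣ c ∣      ≡⟨ sym (ℤP.∣i*j∣≡∣i∣*∣j∣ (x j) c) ⟩
    ∣ x j * c ∣            ≡⟨ cong ∣_∣ (sym (prodOver-∁⁅x⁆ a x j≢i)) ⟩
    ∣ P ∣                  ≤⟨ ∣i∣≤∣i-j∣+∣j∣ P (x i) ⟩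
    ∣ P - x i ∣ ℕ.+ ∣ x i ∣ ≤⟨ ℕP.+-monoˡ-≤ ∣ x i ∣ close ⟩
    ∣ x i ∣ ℕ.+ ∣ x i ∣    ∎
  0<∣xᵢ∣ : 0 < ∣ x i ∣
  0<∣xᵢ∣ with avoid-two i j
  ... | l , l≢i , l≢j =
    ℕP.n≢0⇒n>0 (∉T⇒x≢0 {i} {j} {l} (≢-sym j≢i) (≢-sym l≢i) l≢j ∘ ℤP.∣i∣≡0⇒i≡0)
lemma2p1 a k (suc (suc zero)) _ (s≤s (s≤s ())) x x∈V x∉T i close j j≢i
lemma2p1 a k (suc zero) _ (s≤s ()) x x∈V x∉T i close j j≢i
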